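{- Let $\Gamma$ be a graph on $v\ge3$ vertices that is not a complete multipartite graph. Then $\theta_m<0<\theta_M$.
   Context: Complete graphs and edgeless graphs count as complete multipartite graphs. For a graph $\Gamma=(V,E)$ on $v$ vertices, let $\bar k=2|E|/v$, let $N$ be the number of triangles, $\bar\lambda=\frac{6N}{v\bar k}$, $$\bar s=\frac{ -(\bar k^2-\bar k+\bar\lambda-\bar\lambda v)+\sqrt{(\bar k^2-\bar k+\bar\lambda-\bar\lambda v)^2+4\bar k(v-\bar k-1)(v+\bar\lambda-2\bar k)}}{2(v+\bar\lambda-2\bar k)},$$ $\bar\mu=\frac{\bar k(\bar k-\bar\lambda-1)}{v-\bar k-1}$, $\theta_m=-\frac{\bar k}{\bar s}$ and $\theta_M=\frac{\bar k-\bar\mu}{\bar k}\bar s$. -}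

module Defs where

open import Level using (0ℓ)
open import Data.Bool using (Bool; true; false; _∧_; if_then_else_)
open import Data.Nat as ℕ using (ℕ; zero; suc; _<ᵇ_)
open import Data.Fin using (Fin; toℕ) renaming (zero to fzero; suc to fsuc)
open import Data.Product using (Σ; _×_)
open import Data.Sum using (_⊎_)
open import Relation.Binary.PropositionalEquality using (_≡_; _≢_)
open import Relation.Nullary using (¬_)
open import Function.Bundles using (_⇔_)
open import Algebra.Structures using (IsCommutativeRing)

record Graph (v : ℕ) : Set where
  field
    adj     : Fin v → Fin v → Bool
    sym     : ∀ i j → adj i j ≡ adj j i
    irrefl  : ∀ i → adj i i ≡ false

-- Complete multipartite: there is a labelling of the vertices by parts
-- such that two vertices are adjacent iff they lie in different parts.
-- (Complete graphs: injective labelling; edgeless graphs: constant one.)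
IsCompleteMultipartite : ∀ {v} → Graph v → Set
IsCompleteMultipartite {v} Γ =
  Σ (Fin v → Fin v) λ part →
    ∀ i j → (Graph.adj Γ i j ≡ true) ⇔ (part i ≢ part j)

Σℕ : ∀ {n} → (Fin n → ℕ) → ℕ
Σℕ {zero}  f = 0
Σℕ {suc n} f = f fzero ℕ.+ Σℕ {n} (λ i → f (fsuc i))

b2n : Bool → ℕ
b2n true  = 1
b2n false = 0

numEdges : ∀ {v} → Graph v → ℕ
numEdges Γ = Σℕ λ i → Σℕ λ j → b2n ((toℕ i <ᵇ toℕ j) ∧ adj i j)
  where open Graph Γ

numTriangles : ∀ {v} → Graph v → ℕ
numTriangles Γ = Σℕ λ i → Σℕ λ j → Σℕ λ l →
  b2n ((toℕ i <ᵇ toℕ j) ∧ (toℕ j <ᵇ toℕ l) ∧ adj i j ∧ adj j l ∧ adj i l)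
  where open Graph Γ

-- We work in an
-- arbitrary ordered field in which nonnegative elements have square
-- roots (a Euclidean field, e.g. ℝ).  Division is total with the
-- convention 0⁻¹ = 0.

record EuclideanField : Set₁ where
  infixl 6 _+_ _-_
  infixl 7 _*_ _/_
  infix  4 _<_ _≤_
  field
    Carrier : Set
    _+_ _*_ : Carrier → Carrier → Carrier
    -_      : Carrier → Carrier
    0# 1#   : Carrier
    _⁻¹     : Carrier → Carrier
    _<_     : Carrier → Carrier → Set
    √       : Carrier → Carrier
    isCommutativeRing : IsCommutativeRing _≡_ _+_ _*_ -_ 0# 1#
    0≢1       : 0# ≢ 1#
    ⁻¹-inverse : ∀ x → x ≢ 0# → x * (x ⁻¹) ≡ 1#
    0⁻¹≡0     : 0# ⁻¹ ≡ 0#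
    <-irrefl  : ∀ x → ¬ (x < x)
    <-trans   : ∀ {x y z} → x < y → y < z → x < z
    <-trichotomy : ∀ x y → x < y ⊎ x ≡ y ⊎ y < x
    +-mono-<  : ∀ {x y} z → x < y → x + z < y + z
    *-pos     : ∀ {x y} → 0# < x → 0# < y → 0# < x * y
    √-nonneg  : ∀ x → ¬ (√ x < 0#)
    √-square  : ∀ x → ¬ (x < 0#) → √ x * √ x ≡ x

  _-_ : Carrier → Carrier → Carrier
  x - y = x + (- y)

  _/_ : Carrier → Carrier → Carrier
  x / y = x * (y ⁻¹)

  _≤_ : Carrier → Carrier → Set
  x ≤ y = ¬ (y < x)

  fromℕ : ℕ → Carrier
  fromℕ zero    = 0#
  fromℕ (suc n) = 1# + fromℕ n

module Params (F : EuclideanField) {v : ℕ} (Γ : Graph v) where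
  open EuclideanField F

  V : Carrier
  V = fromℕ v

  kbar : Carrier
  kbar = fromℕ (2 ℕ.* numEdges Γ) / V

  λbar : Carrier
  λbar = fromℕ (6 ℕ.* numTriangles Γ) / (V * kbar)

  bcoef : Carrier
  bcoef = kbar * kbar - kbar + λbar - λbar * V

  acoef : Carrier
  acoef = V + λbar - fromℕ 2 * kbar

  sbar : Carrier
  sbar = (- bcoef + √ (bcoef * bcoef
                       + fromℕ 4 * kbar * (V - kbar - 1#) * acoef))
         / (fromℕ 2 * acoef)

  μbar : Carrier
  μbar = kbar * (kbar - λbar - 1#) / (V - kbar - 1#)

  θm : Carrier
  θm = - (kbar / sbar)

  θM : Carrier
  θM = ((kbar - μbar) / kbar) * sbar

module Submission where

-- Write S = Σ deg = 2|E|, Q = Σ deg² and T = Σ A_ij A_jl A_il = 6N, so that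
-- k̄ = S/v and λ̄ = T/S.  Everything follows from the positivity of k̄,
-- w = v − k̄ − 1 and a = v + λ̄ − 2k̄: then s̄ > 0, being the root taken with
-- +√ of a quadratic whose discriminant exceeds b², and (k̄ − μ̄) w = k̄ a > 0.
-- Now w v = v² − S − v > 0 because a vertex with a non-neighbour has degree
-- at most v − 2, and a v S = v² S + v T − 2 S² > 0 by Cauchy–Schwarz S² ≤ v Q
-- and 2Q < v S + T.  The latter is deg i + deg j ≤ v + |N(i) ∩ N(j)| summed
-- over ordered edges ij, strict for an edge bc and a vertex a adjacent to
-- neither end.  Such an induced K₁ + K₂ exists unless non-adjacency is an
-- equivalence relation, in which case its classes are the parts of a complete
-- multipartite structure.

open import Defs
open import Data.Nat using (ℕ; _≤_)
open import Data.Product using (_×_; _,_)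
open import Relation.Nullary using (¬_)

module EuclideanFieldProperties (F : EuclideanField) where
  open EuclideanField F hiding (_≤_)
  open import Level using (0ℓ)
  open import Algebra.Bundles using (CommutativeRing; RawRing)
  open import Algebra.Solver.Ring.AlmostCommutativeRing
    using (_-Raw-AlmostCommutative⟶_; fromCommutativeRing)
  open import Data.Nat as ℕ using (zero; suc; s≤s; z≤n)
  import Data.Nat.Properties as ℕ
  open import Data.Maybe using (Maybe; just; nothing)
  open import Data.Product using (_,_)
  open import Data.Sum using (_⊎_; inj₁; inj₂)
  open import Data.Empty using (⊥; ⊥-elim)
  open import Relation.Nullary using (yes; no)
  open import Relation.Binary.PropositionalEquality
  open ≡-Reasoning

  commutativeRing : CommutativeRing 0ℓ 0ℓ
  commutativeRing = record { isCommutativeRing = isCommutativeRing }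

  open CommutativeRing commutativeRing
    using ( +-assoc; +-comm; +-identityˡ; +-identityʳ; -‿inverseʳ; -‿inverseˡ
          ; *-comm; *-assoc; *-identityˡ; *-identityʳ; zeroˡ; distribʳ
          ; ring; semiring; +-abelianGroup; +-commutativeSemigroup)
  open import Algebra.Properties.Ring ring
    using (-‿involutive; -‿distribˡ-*; -0#≈0#; x[y-z]≈xy-xz; [y-z]x≈yx-zx)
  open import Algebra.Properties.AbelianGroup +-abelianGroup using (⁻¹-∙-comm)
  open import Algebra.Properties.CommutativeSemigroup +-commutativeSemigroup
    using (interchange)
  open import Algebra.Properties.Semiring.Mult semiring
    using (×-homo-+; ×1-homo-*) renaming (_×_ to _·_)

  fromℕ≡·1# : ∀ n → fromℕ n ≡ n · 1#
  fromℕ≡·1# zero    = refl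
  fromℕ≡·1# (suc n) = cong (1# +_) (fromℕ≡·1# n)

  fromℕ-+ : ∀ m n → fromℕ (m ℕ.+ n) ≡ fromℕ m + fromℕ n
  fromℕ-+ m n = begin
    fromℕ (m ℕ.+ n)         ≡⟨ fromℕ≡·1# (m ℕ.+ n) ⟩
    (m ℕ.+ n) · 1#          ≡⟨ ×-homo-+ 1# m n ⟩
    m · 1# + n · 1#         ≡⟨ sym (cong₂ _+_ (fromℕ≡·1# m) (fromℕ≡·1# n)) ⟩
    fromℕ m + fromℕ n       ∎

  fromℕ-* : ∀ m n → fromℕ (m ℕ.* n) ≡ fromℕ m * fromℕ n
  fromℕ-* m n = begin
    fromℕ (m ℕ.* n)         ≡⟨ fromℕ≡·1# (m ℕ.* n) ⟩
    (m ℕ.* n) · 1#          ≡⟨ ×1-homo-* m n ⟩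
    m · 1# * n · 1#         ≡⟨ sym (cong₂ _*_ (fromℕ≡·1# m) (fromℕ≡·1# n)) ⟩
    fromℕ m * fromℕ n       ∎

  -[x-y]≡y-x : ∀ x y → - (x - y) ≡ y - x
  -[x-y]≡y-x x y = begin
    - (x + - y)     ≡⟨ sym (⁻¹-∙-comm x (- y)) ⟩
    - x + - - y     ≡⟨ cong (- x +_) (-‿involutive y) ⟩
    - x + y         ≡⟨ +-comm (- x) y ⟩
    y - x           ∎

  -- The solver needs coefficients with decidable equality, which the carrier
  -- lacks; we use pairs (a , b) of naturals standing for the integer a - b.
  module Solver where
    Coeff : RawRing 0ℓ 0ℓ
    Coeff = record
      { Carrier = ℕ × ℕ ; _≈_ = _≡_
      ; _+_ = λ { (a , b) (c , d) → a ℕ.+ c , b ℕ.+ d }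
      ; _*_ = λ { (a , b) (c , d) → a ℕ.* c ℕ.+ b ℕ.* d , a ℕ.* d ℕ.+ b ℕ.* c }
      ; -_  = λ { (a , b) → b , a }
      ; 0#  = 0 , 0
      ; 1#  = 1 , 0
      }

    ⟦_⟧ : ℕ × ℕ → Carrier
    ⟦ a , b ⟧ = fromℕ a - fromℕ b

    [a+c]-[b+d]≡[a-b]+[c-d] : ∀ a b c d → (a + c) - (b + d) ≡ (a - b) + (c - d)
    [a+c]-[b+d]≡[a-b]+[c-d] a b c d = begin
      (a + c) - (b + d)       ≡⟨ cong ((a + c) +_) (sym (⁻¹-∙-comm b d)) ⟩
      (a + c) + (- b + - d)   ≡⟨ interchange a c (- b) (- d) ⟩
      (a - b) + (c - d)       ∎

    [ac+bd]-[ad+bc]≡[a-b][c-d] : ∀ a b c d → (a * c + b * d) - (a * d + b * c) ≡ (a - b) * (c - d)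
    [ac+bd]-[ad+bc]≡[a-b][c-d] a b c d = sym (begin
      (a - b) * (c - d)                          ≡⟨ [y-z]x≈yx-zx (c - d) a b ⟩
      a * (c - d) - b * (c - d)                  ≡⟨ cong₂ _-_ (x[y-z]≈xy-xz a c d) (x[y-z]≈xy-xz b c d) ⟩
      (a * c - a * d) - (b * c - b * d)          ≡⟨ cong ((a * c - a * d) +_) (-[x-y]≡y-x (b * c) (b * d)) ⟩
      (a * c - a * d) + (b * d - b * c)          ≡⟨ interchange (a * c) (- (a * d)) (b * d) (- (b * c)) ⟩
      (a * c + b * d) + (- (a * d) + - (b * c))  ≡⟨ cong ((a * c + b * d) +_) (⁻¹-∙-comm (a * d) (b * c)) ⟩
      (a * c + b * d) - (a * d + b * c)          ∎)

    a+d≡c+b⇒a-b≡c-d : ∀ {a b c d} → a + d ≡ c + b → a - b ≡ c - d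
    a+d≡c+b⇒a-b≡c-d {a} {b} {c} {d} a+d≡c+b = begin
      a - b                         ≡⟨ sym (+-identityʳ (a - b)) ⟩
      (a - b) + 0#                  ≡⟨ cong ((a - b) +_) (sym (-‿inverseʳ d)) ⟩
      (a - b) + (d - d)             ≡⟨ interchange a (- b) d (- d) ⟩
      (a + d) + (- b + - d)         ≡⟨ cong₂ _+_ a+d≡c+b (+-comm (- b) (- d)) ⟩
      (c + b) + (- d + - b)         ≡⟨ interchange c b (- d) (- b) ⟩
      (c - d) + (b - b)             ≡⟨ cong ((c - d) +_) (-‿inverseʳ b) ⟩
      (c - d) + 0#                  ≡⟨ +-identityʳ (c - d) ⟩
      c - d                         ∎

    fromℕ-*+* : ∀ a b c d → fromℕ (a ℕ.* b ℕ.+ c ℕ.* d) ≡ fromℕ a * fromℕ b + fromℕ c * fromℕ d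
    fromℕ-*+* a b c d = trans (fromℕ-+ (a ℕ.* b) (c ℕ.* d)) (cong₂ _+_ (fromℕ-* a b) (fromℕ-* c d))

    morphism : Coeff -Raw-AlmostCommutative⟶ fromCommutativeRing commutativeRing
    morphism = record
      { ⟦_⟧    = ⟦_⟧
      ; +-homo = λ { (a , b) (c , d) →
          trans (cong₂ _-_ (fromℕ-+ a c) (fromℕ-+ b d)) ([a+c]-[b+d]≡[a-b]+[c-d] _ _ _ _) }
      ; *-homo = λ { (a , b) (c , d) →
          trans (cong₂ _-_ (fromℕ-*+* a c b d) (fromℕ-*+* a d b c)) ([ac+bd]-[ad+bc]≡[a-b][c-d] _ _ _ _) }
      ; -‿homo = λ { (a , b) → sym (-[x-y]≡y-x (fromℕ a) (fromℕ b)) }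
      ; 0-homo = -‿inverseʳ 0#
      ; 1-homo = trans (cong (_- 0#) (+-identityʳ 1#)) (trans (cong (1# +_) -0#≈0#) (+-identityʳ 1#))
      }

    coeff-≟ : ∀ x y → Maybe (⟦ x ⟧ ≡ ⟦ y ⟧)
    coeff-≟ (a , b) (c , d) with a ℕ.+ d ℕ.≟ c ℕ.+ b
    ... | yes eq = just (a+d≡c+b⇒a-b≡c-d (trans (sym (fromℕ-+ a d)) (trans (cong fromℕ eq) (fromℕ-+ c b))))
    ... | no _   = nothing

    open import Algebra.Solver.Ring Coeff (fromCommutativeRing commutativeRing) morphism coeff-≟ public
      using (solve; _:+_; _:*_; _:-_; :-_; _:=_)

  open Solver using (solve; _:+_; _:*_; _:-_; :-_; _:=_)

  <-asym : ∀ {x y} → x < y → y < x → ⊥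
  <-asym x<y y<x = <-irrefl _ (<-trans x<y y<x)

  ≮-<-trans : ∀ {x y z} → ¬ (y < x) → y < z → x < z
  ≮-<-trans {x} {y} {z} y≮x y<z with <-trichotomy x z
  ... | inj₁ x<z         = x<z
  ... | inj₂ (inj₁ refl) = ⊥-elim (y≮x y<z)
  ... | inj₂ (inj₂ z<x)  = ⊥-elim (y≮x (<-trans y<z z<x))

  +-monoʳ-< : ∀ {x y} z → x < y → z + x < z + y
  +-monoʳ-< {x} {y} z x<y = subst₂ _<_ (+-comm x z) (+-comm y z) (+-mono-< z x<y)

  x<y⇒0<y-x : ∀ {x y} → x < y → 0# < y - x
  x<y⇒0<y-x {x} x<y = subst (_< _) (-‿inverseʳ x) (+-mono-< (- x) x<y)

  0<y-x⇒x<y : ∀ {x y} → 0# < y - x → x < y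
  0<y-x⇒x<y {x} {y} 0<y-x = subst₂ _<_ (+-identityˡ x) y-x+x≡y (+-mono-< x 0<y-x)
    where
    y-x+x≡y : (y - x) + x ≡ y
    y-x+x≡y = trans (+-assoc y (- x) x) (trans (cong (y +_) (-‿inverseˡ x)) (+-identityʳ y))

  x<0⇒0<-x : ∀ {x} → x < 0# → 0# < - x
  x<0⇒0<-x {x} x<0 = subst₂ _<_ (-‿inverseʳ x) (+-identityˡ (- x)) (+-mono-< (- x) x<0)

  0<x⇒-x<0 : ∀ {x} → 0# < x → - x < 0#
  0<x⇒-x<0 {x} 0<x = subst₂ _<_ (+-identityˡ (- x)) (-‿inverseʳ x) (+-mono-< (- x) 0<x)

  0<x⇒x≢0 : ∀ {x} → 0# < x → x ≢ 0#
  0<x⇒x≢0 0<x refl = <-irrefl 0# 0<x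

  -x*-x≡x*x : ∀ x → - x * - x ≡ x * x
  -x*-x≡x*x = solve 1 (λ x → :- x :* :- x := x :* x) refl

  x*x≮0 : ∀ x → ¬ (x * x < 0#)
  x*x≮0 x x*x<0 with <-trichotomy x 0#
  ... | inj₁ x<0        = <-asym x*x<0 (subst (0# <_) (-x*-x≡x*x x) (*-pos (x<0⇒0<-x x<0) (x<0⇒0<-x x<0)))
  ... | inj₂ (inj₁ refl) = <-irrefl 0# (subst (_< 0#) (zeroˡ 0#) x*x<0)
  ... | inj₂ (inj₂ 0<x) = <-asym x*x<0 (*-pos 0<x 0<x)

  0<1 : 0# < 1#
  0<1 with <-trichotomy 0# 1#
  ... | inj₁ 0<1         = 0<1
  ... | inj₂ (inj₁ 0≡1)  = ⊥-elim (0≢1 0≡1)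
  ... | inj₂ (inj₂ 1<0)  = ⊥-elim (x*x≮0 1# (subst (_< 0#) (sym (*-identityˡ 1#)) 1<0))

  +-pos : ∀ {x y} → 0# < x → 0# < y → 0# < x + y
  +-pos {x} {y} 0<x 0<y = <-trans 0<y (subst (_< x + y) (+-identityˡ y) (+-mono-< y 0<x))

  +-nonneg-pos : ∀ {x y} → ¬ (x < 0#) → 0# < y → 0# < x + y
  +-nonneg-pos {x} {y} x≮0 0<y with <-trichotomy x 0#
  ... | inj₁ x<0        = ⊥-elim (x≮0 x<0)
  ... | inj₂ (inj₁ refl) = subst (0# <_) (sym (+-identityˡ y)) 0<y
  ... | inj₂ (inj₂ 0<x) = +-pos 0<x 0<y

  *-cancelʳ-pos : ∀ {x y} → 0# < y → 0# < x * y → 0# < x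
  *-cancelʳ-pos {x} {y} 0<y 0<xy with <-trichotomy x 0#
  ... | inj₁ x<0        =
    ⊥-elim (<-asym 0<xy (subst (_< 0#) -[-x*y]≡x*y (0<x⇒-x<0 (*-pos (x<0⇒0<-x x<0) 0<y))))
    where
    -[-x*y]≡x*y : - (- x * y) ≡ x * y
    -[-x*y]≡x*y = trans (cong -_ (sym (-‿distribˡ-* x y))) (-‿involutive (x * y))
  ... | inj₂ (inj₁ refl) = ⊥-elim (<-irrefl 0# (subst (0# <_) (zeroˡ y) 0<xy))
  ... | inj₂ (inj₂ 0<x) = 0<x

  ⁻¹-pos : ∀ {x} → 0# < x → 0# < x ⁻¹
  ⁻¹-pos {x} 0<x = *-cancelʳ-pos 0<x
    (subst (0# <_) (trans (sym (⁻¹-inverse x (0<x⇒x≢0 0<x))) (*-comm x (x ⁻¹))) 0<1)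

  /-pos : ∀ {x y} → 0# < x → 0# < y → 0# < x / y
  /-pos 0<x 0<y = *-pos 0<x (⁻¹-pos 0<y)

  /-*-cancel : ∀ x {y} → 0# < y → x / y * y ≡ x
  /-*-cancel x {y} 0<y = begin
    x * y ⁻¹ * y      ≡⟨ *-assoc x (y ⁻¹) y ⟩
    x * (y ⁻¹ * y)    ≡⟨ cong (x *_) (trans (*-comm (y ⁻¹) y) (⁻¹-inverse y (0<x⇒x≢0 0<y))) ⟩
    x * 1#            ≡⟨ *-identityʳ x ⟩
    x                 ∎

  fromℕ-mono-< : ∀ {m n} → m ℕ.< n → fromℕ m < fromℕ n
  fromℕ-mono-< {zero} {suc zero} _ = subst (0# <_) (sym (+-identityʳ 1#)) 0<1
  fromℕ-mono-< {zero} {suc (suc n)} _ = +-pos 0<1 (fromℕ-mono-< {zero} {suc n} (s≤s z≤n))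
  fromℕ-mono-< {suc m} {suc n} (s≤s m<n) = +-monoʳ-< 1# (fromℕ-mono-< m<n)

  x*x<y*y : ∀ {x y} → ¬ (x < 0#) → x < y → x * x < y * y
  x*x<y*y {x} {y} x≮0 x<y =
    0<y-x⇒x<y (subst (0# <_) (sym y*y-x*x≡[y-x][x+y])
      (*-pos (x<y⇒0<y-x x<y) (+-nonneg-pos x≮0 (≮-<-trans x≮0 x<y))))
    where
    y*y-x*x≡[y-x][x+y] : y * y - x * x ≡ (y - x) * (x + y)
    y*y-x*x≡[y-x][x+y] = solve 2 (λ x y → y :* y :- x :* x := (y :- x) :* (x :+ y)) refl x y

  <√ : ∀ {x y} → y * y < x → y < √ x
  <√ {x} {y} y*y<x = compare (<-trichotomy y (√ x))
    where
    √x*√x≡x : √ x * √ x ≡ x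
    √x*√x≡x = √-square x (λ x<0 → x*x≮0 y (<-trans y*y<x x<0))

    compare : y < √ x ⊎ y ≡ √ x ⊎ √ x < y → y < √ x
    compare (inj₁ y<√x)        = y<√x
    compare (inj₂ (inj₁ refl)) = ⊥-elim (<-irrefl x (subst (_< x) √x*√x≡x y*y<x))
    compare (inj₂ (inj₂ √x<y)) =
      ⊥-elim (<-asym y*y<x (subst (_< y * y) √x*√x≡x (x*x<y*y (√-nonneg x) √x<y)))

  quadratic-root-pos : ∀ a b c → 0# < a → 0# < c →
                       0# < (- b + √ (b * b + c)) / (fromℕ 2 * a)
  quadratic-root-pos a b c 0<a 0<c =
    /-pos (subst (0# <_) (+-comm (√ (b * b + c)) (- b)) (x<y⇒0<y-x (<√ b*b<b*b+c)))
          (*-pos (fromℕ-mono-< {0} {2} (s≤s z≤n)) 0<a)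
    where
    b*b<b*b+c : b * b < b * b + c
    b*b<b*b+c = subst₂ _<_ (+-identityˡ (b * b)) (+-comm c (b * b)) (+-mono-< (b * b) 0<c)

  2*x≡x+x : ∀ x → fromℕ 2 * x ≡ x + x
  2*x≡x+x x = begin
    (1# + (1# + 0#)) * x   ≡⟨ cong (λ u → (1# + u) * x) (+-identityʳ 1#) ⟩
    (1# + 1#) * x          ≡⟨ distribʳ x 1# 1# ⟩
    1# * x + 1# * x        ≡⟨ cong₂ _+_ (*-identityˡ x) (*-identityˡ x) ⟩
    x + x                  ∎

module b2n-Properties where
  open import Data.Bool using (true; false; _∧_)
  open import Data.Nat using (_+_; _*_; z≤n)
  open import Data.Nat.Properties using (+-identityʳ; ≤-refl)
  open import Relation.Binary.PropositionalEquality using (_≡_; refl; sym)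

  b2n-∧ : ∀ p q → b2n (p ∧ q) ≡ b2n p * b2n q
  b2n-∧ true  q = sym (+-identityʳ (b2n q))
  b2n-∧ false q = refl

  b2n≤1 : ∀ p → b2n p ≤ 1
  b2n≤1 true  = ≤-refl
  b2n≤1 false = z≤n

  b2n+b2n≤1+b2n*b2n : ∀ p q → b2n p + b2n q ≤ 1 + b2n p * b2n q
  b2n+b2n≤1+b2n*b2n true  true  = ≤-refl
  b2n+b2n≤1+b2n*b2n true  false = ≤-refl
  b2n+b2n≤1+b2n*b2n false true  = ≤-refl
  b2n+b2n≤1+b2n*b2n false false = z≤n

module Σℕ-Properties where
  open import Data.Nat using (zero; suc; _+_; _*_; _<_; z≤n)
  open import Data.Nat.Properties
  open import Data.Nat.Solver using (module +-*-Solver)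
  open +-*-Solver using (solve; _:+_; _:*_; _:=_; con)
  open import Data.Product using (_,_)
  open import Data.Sum using (inj₁; inj₂)
  open import Algebra.Properties.CommutativeSemigroup +-commutativeSemigroup using (interchange)
  open import Data.Fin using (Fin) renaming (zero to fzero; suc to fsuc)
  open import Data.Empty using (⊥-elim)
  open import Function using (_∘_)
  open import Relation.Binary.PropositionalEquality

  Σℕ-cong : ∀ {n} {f g : Fin n → ℕ} → (∀ i → f i ≡ g i) → Σℕ f ≡ Σℕ g
  Σℕ-cong {zero}  f≗g = refl
  Σℕ-cong {suc n} f≗g = cong₂ _+_ (f≗g fzero) (Σℕ-cong (f≗g ∘ fsuc))

  Σℕ-distrib-+ : ∀ {n} (f g : Fin n → ℕ) → Σℕ (λ i → f i + g i) ≡ Σℕ f + Σℕ g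
  Σℕ-distrib-+ {zero}  f g = refl
  Σℕ-distrib-+ {suc n} f g =
    trans (cong (f fzero + g fzero +_) (Σℕ-distrib-+ (f ∘ fsuc) (g ∘ fsuc)))
          (interchange (f fzero) (g fzero) (Σℕ (f ∘ fsuc)) (Σℕ (g ∘ fsuc)))

  *-distribˡ-Σℕ : ∀ {n} c (f : Fin n → ℕ) → Σℕ (λ i → c * f i) ≡ c * Σℕ f
  *-distribˡ-Σℕ {zero}  c f = sym (*-zeroʳ c)
  *-distribˡ-Σℕ {suc n} c f =
    trans (cong (c * f fzero +_) (*-distribˡ-Σℕ c (f ∘ fsuc))) (sym (*-distribˡ-+ c _ _))

  *-distribʳ-Σℕ : ∀ {n} c (f : Fin n → ℕ) → Σℕ (λ i → f i * c) ≡ Σℕ f * c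
  *-distribʳ-Σℕ c f =
    trans (Σℕ-cong (λ i → *-comm (f i) c)) (trans (*-distribˡ-Σℕ c f) (*-comm c (Σℕ f)))

  Σℕ-const : ∀ n c → Σℕ {n} (λ _ → c) ≡ n * c
  Σℕ-const zero    c = refl
  Σℕ-const (suc n) c = cong (c +_) (Σℕ-const n c)

  Σℕ-comm : ∀ {m n} (f : Fin m → Fin n → ℕ) →
            Σℕ (λ i → Σℕ (λ j → f i j)) ≡ Σℕ (λ j → Σℕ (λ i → f i j))
  Σℕ-comm {zero}  {n} f = sym (trans (Σℕ-const n 0) (*-zeroʳ n))
  Σℕ-comm {suc m} {n} f =
    trans (cong (Σℕ (f fzero) +_) (Σℕ-comm (f ∘ fsuc)))
          (sym (Σℕ-distrib-+ (f fzero) (λ j → Σℕ (λ i → f (fsuc i) j))))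

  Σℕ-ones : ∀ n → Σℕ {n} (λ _ → 1) ≡ n
  Σℕ-ones n = trans (Σℕ-const n 1) (*-identityʳ n)

  term≤Σℕ : ∀ {n} (f : Fin n → ℕ) x → f x ≤ Σℕ f
  term≤Σℕ f fzero    = m≤m+n (f fzero) _
  term≤Σℕ f (fsuc x) = ≤-trans (term≤Σℕ (f ∘ fsuc) x) (m≤n+m _ (f fzero))

  Σℕ-mono-≤ : ∀ {n} {f g : Fin n → ℕ} → (∀ i → f i ≤ g i) → Σℕ f ≤ Σℕ g
  Σℕ-mono-≤ {zero}  f≤g = z≤n
  Σℕ-mono-≤ {suc n} f≤g = +-mono-≤ (f≤g fzero) (Σℕ-mono-≤ (f≤g ∘ fsuc))

  Σℕ-mono-< : ∀ {n} {f g : Fin n → ℕ} → (∀ i → f i ≤ g i) →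
              ∀ x → f x < g x → Σℕ f < Σℕ g
  Σℕ-mono-< f≤g fzero    fx<gx = +-mono-<-≤ fx<gx (Σℕ-mono-≤ (f≤g ∘ fsuc))
  Σℕ-mono-< f≤g (fsuc x) fx<gx = +-mono-≤-< (f≤g fzero) (Σℕ-mono-< (f≤g ∘ fsuc) x fx<gx)

  Σℕ-mono-<₂ : ∀ {n} {f g : Fin n → ℕ} → (∀ i → f i ≤ g i) →
               ∀ x y → x ≢ y → f x < g x → f y < g y → 2 + Σℕ f ≤ Σℕ g
  Σℕ-mono-<₂ f≤g fzero    fzero    x≢y _ _ = ⊥-elim (x≢y refl)
  Σℕ-mono-<₂ {f = f} f≤g fzero (fsuc y) _ fx<gx fy<gy =
    ≤-trans (≤-reflexive (sym (cong suc (+-suc (f fzero) _))))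
            (+-mono-≤ fx<gx (Σℕ-mono-< (f≤g ∘ fsuc) y fy<gy))
  Σℕ-mono-<₂ f≤g (fsuc x) fzero    x≢y fx<gx fy<gy =
    Σℕ-mono-<₂ f≤g fzero (fsuc x) (x≢y ∘ sym) fy<gy fx<gx
  Σℕ-mono-<₂ {f = f} f≤g (fsuc x) (fsuc y) x≢y fx<gx fy<gy =
    ≤-trans (≤-reflexive (sym (trans (+-suc (f fzero) _) (cong suc (+-suc (f fzero) _)))))
      (+-mono-≤ (f≤g fzero) (Σℕ-mono-<₂ (f≤g ∘ fsuc) x y (x≢y ∘ cong fsuc) fx<gx fy<gy))

  m≤n⇒2*m*n≤m*m+n*n : ∀ {m n} → m ≤ n → 2 * (m * n) ≤ m * m + n * n
  m≤n⇒2*m*n≤m*m+n*n {m} m≤n with m≤n⇒∃[o]m+o≡n m≤n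
  ... | k , refl = ≤-trans (m≤m+n _ (k * k)) (≤-reflexive
    (solve 2 (λ m k → con 2 :* (m :* (m :+ k)) :+ k :* k := m :* m :+ (m :+ k) :* (m :+ k)) refl m k))

  2*m*n≤m*m+n*n : ∀ m n → 2 * (m * n) ≤ m * m + n * n
  2*m*n≤m*m+n*n m n with ≤-total m n
  ... | inj₁ m≤n = m≤n⇒2*m*n≤m*m+n*n m≤n
  ... | inj₂ n≤m = subst₂ _≤_ (cong (2 *_) (*-comm n m)) (+-comm (n * n) (m * m)) (m≤n⇒2*m*n≤m*m+n*n n≤m)

  Σℕ-square≤ : ∀ {n} (f : Fin n → ℕ) → Σℕ f * Σℕ f ≤ n * Σℕ (λ i → f i * f i)
  Σℕ-square≤ {n} f = *-cancelˡ-≤ 2 (begin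
    2 * (Σℕ f * Σℕ f)
      ≡⟨ cong (2 *_) square≡double-sum ⟩
    2 * Σℕ (λ i → Σℕ λ j → f i * f j)
      ≡⟨ sym (trans (Σℕ-cong λ i → *-distribˡ-Σℕ 2 λ j → f i * f j)
                    (*-distribˡ-Σℕ 2 λ i → Σℕ λ j → f i * f j)) ⟩
    Σℕ (λ i → Σℕ λ j → 2 * (f i * f j))
      ≤⟨ Σℕ-mono-≤ (λ i → Σℕ-mono-≤ λ j → 2*m*n≤m*m+n*n (f i) (f j)) ⟩
    Σℕ (λ i → Σℕ λ j → f i * f i + f j * f j)
      ≡⟨ Σℕ-cong (λ i → trans (Σℕ-distrib-+ (λ _ → f i * f i) (λ j → f j * f j))
                              (cong (_+ Q) (Σℕ-const n (f i * f i)))) ⟩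
    Σℕ (λ i → n * (f i * f i) + Q)
      ≡⟨ trans (Σℕ-distrib-+ (λ i → n * (f i * f i)) (λ _ → Q))
               (cong₂ _+_ (*-distribˡ-Σℕ n (λ i → f i * f i)) (Σℕ-const n Q)) ⟩
    n * Q + n * Q
      ≡⟨ solve 1 (λ x → x :+ x := con 2 :* x) refl (n * Q) ⟩
    2 * (n * Q) ∎)
    where
    open ≤-Reasoning
    Q : ℕ
    Q = Σℕ (λ i → f i * f i)

    square≡double-sum : Σℕ f * Σℕ f ≡ Σℕ (λ i → Σℕ λ j → f i * f j)
    square≡double-sum = sym (trans (Σℕ-cong λ i → *-distribˡ-Σℕ (f i) f) (*-distribʳ-Σℕ (Σℕ f) f))

module SymmetricSums where
  open import Data.Bool using (true; false)
  open import Data.Bool.Properties using (T-≡)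
  open import Data.Nat using (_+_; _*_; _<_; _<ᵇ_)
  open import Data.Nat.Properties
  open import Data.Nat.Solver using (module +-*-Solver)
  open +-*-Solver using (solve; _:+_; _:*_; _:=_; con)
  open import Data.Fin using (Fin; toℕ)
  import Data.Fin.Properties as Fin
  open import Data.Product using (_,_)
  open import Data.Sum using (_⊎_; inj₁; inj₂)
  open import Data.Empty using (⊥-elim)
  open import Function.Bundles using (Equivalence)
  open import Relation.Nullary using (yes; no)
  open import Relation.Binary.Definitions using (tri<; tri≈; tri>)
  open import Relation.Binary.PropositionalEquality
  open ≡-Reasoning
  open Σℕ-Properties

  Σ² : ∀ {n} → (Fin n → Fin n → ℕ) → ℕ
  Σ² g = Σℕ λ i → Σℕ λ j → g i j

  Σ³ : ∀ {n} → (Fin n → Fin n → Fin n → ℕ) → ℕ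
  Σ³ f = Σℕ λ i → Σℕ λ j → Σℕ λ l → f i j l

  Σ²-cong : ∀ {n} {g h : Fin n → Fin n → ℕ} → (∀ i j → g i j ≡ h i j) → Σ² g ≡ Σ² h
  Σ²-cong g≗h = Σℕ-cong λ i → Σℕ-cong (g≗h i)

  Σ²-distrib-+ : ∀ {n} (g h : Fin n → Fin n → ℕ) → Σ² (λ i j → g i j + h i j) ≡ Σ² g + Σ² h
  Σ²-distrib-+ g h = trans (Σℕ-cong λ i → Σℕ-distrib-+ (g i) (h i))
                           (Σℕ-distrib-+ (λ i → Σℕ (g i)) (λ i → Σℕ (h i)))

  Σ³-cong : ∀ {n} {f g : Fin n → Fin n → Fin n → ℕ} →
            (∀ i j l → f i j l ≡ g i j l) → Σ³ f ≡ Σ³ g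
  Σ³-cong f≗g = Σℕ-cong λ i → Σ²-cong (f≗g i)

  Σ³-distrib-+ : ∀ {n} (f g : Fin n → Fin n → Fin n → ℕ) →
                 Σ³ (λ i j l → f i j l + g i j l) ≡ Σ³ f + Σ³ g
  Σ³-distrib-+ f g = trans (Σℕ-cong λ i → Σ²-distrib-+ (f i) (g i))
                           (Σℕ-distrib-+ (λ i → Σ² (f i)) (λ i → Σ² (g i)))

  lt : ∀ {n} → Fin n → Fin n → ℕ
  lt i j = b2n (toℕ i <ᵇ toℕ j)

  lt≡1 : ∀ {n} {i j : Fin n} → toℕ i < toℕ j → lt i j ≡ 1
  lt≡1 i<j = cong b2n (Equivalence.to T-≡ (<⇒<ᵇ i<j))

  lt≡0 : ∀ {n} {i j : Fin n} → toℕ j < toℕ i → lt i j ≡ 0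
  lt≡0 {i = i} {j} j<i with toℕ i <ᵇ toℕ j | <ᵇ⇒< (toℕ i) (toℕ j)
  ... | false | _   = refl
  ... | true  | i<j = ⊥-elim (<-asym j<i (i<j _))

  LtDichotomy : ∀ {n} → Fin n → Fin n → Set
  LtDichotomy i j = (toℕ i < toℕ j × lt i j ≡ 1 × lt j i ≡ 0)
                  ⊎ (toℕ j < toℕ i × lt i j ≡ 0 × lt j i ≡ 1)

  lt-dichotomy : ∀ {n} {i j : Fin n} → i ≢ j → LtDichotomy i j
  lt-dichotomy {i = i} {j} i≢j with Fin.<-cmp i j
  ... | tri< i<j _ _ = inj₁ (i<j , lt≡1 i<j , lt≡0 i<j)
  ... | tri≈ _ i≡j _ = ⊥-elim (i≢j i≡j)
  ... | tri> _ _ j<i = inj₂ (j<i , lt≡0 j<i , lt≡1 j<i)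

  lt+lt≡1 : ∀ {n} {i j : Fin n} → i ≢ j → lt i j + lt j i ≡ 1
  lt+lt≡1 i≢j with lt-dichotomy i≢j
  ... | inj₁ (_ , lt-ij , lt-ji) rewrite lt-ij | lt-ji = refl
  ... | inj₂ (_ , lt-ij , lt-ji) rewrite lt-ij | lt-ji = refl

  Σ²-symmetric : ∀ {n} (g : Fin n → Fin n → ℕ) → (∀ i j → g j i ≡ g i j) → (∀ i → g i i ≡ 0) →
                 Σ² g ≡ 2 * Σ² (λ i j → lt i j * g i j)
  Σ²-symmetric g g-sym g-diag = begin
    Σ² g
      ≡⟨ Σ²-cong split ⟩
    Σ² (λ i j → lt i j * g i j + lt j i * g i j)
      ≡⟨ Σ²-distrib-+ (λ i j → lt i j * g i j) (λ i j → lt j i * g i j) ⟩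
    S + Σ² (λ i j → lt j i * g i j)
      ≡⟨ cong (S +_) (Σℕ-comm λ i j → lt j i * g i j) ⟩
    S + Σ² (λ i j → lt i j * g j i)
      ≡⟨ cong (S +_) (Σ²-cong λ i j → cong (lt i j *_) (g-sym i j)) ⟩
    S + S
      ≡⟨ cong (S +_) (sym (+-identityʳ S)) ⟩
    2 * S ∎
    where
    S : ℕ
    S = Σ² (λ i j → lt i j * g i j)

    split : ∀ i j → g i j ≡ lt i j * g i j + lt j i * g i j
    split i j with i Fin.≟ j
    ... | yes refl rewrite g-diag i = sym (cong₂ _+_ (*-zeroʳ (lt i i)) (*-zeroʳ (lt i i)))
    ... | no i≢j = begin
      g i j                           ≡⟨ sym (*-identityˡ (g i j)) ⟩
      1 * g i j                       ≡⟨ cong (_* g i j) (sym (lt+lt≡1 i≢j)) ⟩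
      (lt i j + lt j i) * g i j       ≡⟨ *-distribʳ-+ (g i j) (lt i j) (lt j i) ⟩
      lt i j * g i j + lt j i * g i j ∎

  module _ {n : ℕ} where
    Fun³ : Set
    Fun³ = Fin n → Fin n → Fin n → ℕ

    infixl 6 _⊕_
    _⊕_ : Fun³ → Fun³ → Fun³
    (h ⊕ k) i j l = h i j l + k i j l

    swap₁₂ swap₂₃ : Fun³ → Fun³
    swap₁₂ h i j l = h j i l
    swap₂₃ h i j l = h i l j

    -- The symmetric group on three letters is the union of the cosets
    -- ⟨(2 3)⟩, (1 2)⟨(2 3)⟩ and (2 3)(1 2)⟨(2 3)⟩.
    cosets : Fun³ → Fun³
    cosets k = k ⊕ swap₁₂ k ⊕ swap₂₃ (swap₁₂ k)

    symmetrize : Fun³ → Fun³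
    symmetrize h = cosets (h ⊕ swap₂₃ h)

    ordered : Fun³
    ordered i j l = lt i j * lt j l

    symmetrize-ordered≡1 : ∀ {i j l} → i ≢ j → j ≢ l → i ≢ l → symmetrize ordered i j l ≡ 1
    symmetrize-ordered≡1 {i} {j} {l} i≢j j≢l i≢l =
      exactly-one (lt-dichotomy i≢j) (lt-dichotomy j≢l) (lt-dichotomy i≢l)
      where
      -- stated unfolded, so that rewriting with the values of lt reaches them
      exactly-one : LtDichotomy i j → LtDichotomy j l → LtDichotomy i l →
                    lt i j * lt j l + lt i l * lt l j + (lt j i * lt i l + lt j l * lt l i)
                      + (lt l i * lt i j + lt l j * lt j i) ≡ 1
      exactly-one (inj₁ (_ , p₁ , q₁)) (inj₁ (_ , p₂ , q₂)) (inj₁ (_ , p₃ , q₃))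
        rewrite p₁ | q₁ | p₂ | q₂ | p₃ | q₃ = refl
      exactly-one (inj₁ (i<j , _)) (inj₁ (j<l , _)) (inj₂ (l<i , _)) = ⊥-elim (<-asym (<-trans i<j j<l) l<i)
      exactly-one (inj₁ (_ , p₁ , q₁)) (inj₂ (_ , p₂ , q₂)) (inj₁ (_ , p₃ , q₃))
        rewrite p₁ | q₁ | p₂ | q₂ | p₃ | q₃ = refl
      exactly-one (inj₁ (_ , p₁ , q₁)) (inj₂ (_ , p₂ , q₂)) (inj₂ (_ , p₃ , q₃))
        rewrite p₁ | q₁ | p₂ | q₂ | p₃ | q₃ = refl
      exactly-one (inj₂ (_ , p₁ , q₁)) (inj₁ (_ , p₂ , q₂)) (inj₁ (_ , p₃ , q₃))
        rewrite p₁ | q₁ | p₂ | q₂ | p₃ | q₃ = refl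
      exactly-one (inj₂ (_ , p₁ , q₁)) (inj₁ (_ , p₂ , q₂)) (inj₂ (_ , p₃ , q₃))
        rewrite p₁ | q₁ | p₂ | q₂ | p₃ | q₃ = refl
      exactly-one (inj₂ (j<i , _)) (inj₂ (l<j , _)) (inj₁ (i<l , _)) = ⊥-elim (<-asym (<-trans l<j j<i) i<l)
      exactly-one (inj₂ (_ , p₁ , q₁)) (inj₂ (_ , p₂ , q₂)) (inj₂ (_ , p₃ , q₃))
        rewrite p₁ | q₁ | p₂ | q₂ | p₃ | q₃ = refl

    module _ (f : Fun³) where
      weighted : Fun³ → ℕ
      weighted h = Σ³ λ i j l → h i j l * f i j l

      weighted-⊕ : ∀ h k → weighted (h ⊕ k) ≡ weighted h + weighted k
      weighted-⊕ h k = trans (Σ³-cong λ i j l → *-distribʳ-+ (f i j l) (h i j l) (k i j l))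
                             (Σ³-distrib-+ (λ i j l → h i j l * f i j l) (λ i j l → k i j l * f i j l))

    module _ {f : Fun³} (f-swap₁₂ : ∀ i j l → f j i l ≡ f i j l)
             (f-swap₂₃ : ∀ i j l → f i l j ≡ f i j l) where

      weighted-swap₁₂ : ∀ h → weighted f (swap₁₂ h) ≡ weighted f h
      weighted-swap₁₂ h = trans (Σℕ-comm λ i j → Σℕ λ l → h j i l * f i j l)
                                (Σ³-cong λ i j l → cong (h i j l *_) (f-swap₁₂ i j l))

      weighted-swap₂₃ : ∀ h → weighted f (swap₂₃ h) ≡ weighted f h
      weighted-swap₂₃ h = trans (Σℕ-cong λ i → Σℕ-comm λ j l → h i l j * f i j l)
                                (Σ³-cong λ i j l → cong (h i j l *_) (f-swap₂₃ i j l))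

      weighted-cosets : ∀ k → weighted f (cosets k) ≡ 3 * weighted f k
      weighted-cosets k = begin
        weighted f (k ⊕ swap₁₂ k ⊕ swap₂₃ (swap₁₂ k))
          ≡⟨ weighted-⊕ f (k ⊕ swap₁₂ k) (swap₂₃ (swap₁₂ k)) ⟩
        weighted f (k ⊕ swap₁₂ k) + weighted f (swap₂₃ (swap₁₂ k))
          ≡⟨ cong₂ _+_ (weighted-⊕ f k (swap₁₂ k)) (weighted-swap₂₃ (swap₁₂ k)) ⟩
        weighted f k + weighted f (swap₁₂ k) + weighted f (swap₁₂ k)
          ≡⟨ cong (λ x → weighted f k + x + x) (weighted-swap₁₂ k) ⟩
        weighted f k + weighted f k + weighted f k
          ≡⟨ solve 1 (λ W → W :+ W :+ W := con 3 :* W) refl (weighted f k) ⟩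
        3 * weighted f k ∎

      weighted-symmetrize : ∀ h → weighted f (symmetrize h) ≡ 6 * weighted f h
      weighted-symmetrize h = begin
        weighted f (symmetrize h)
          ≡⟨ weighted-cosets (h ⊕ swap₂₃ h) ⟩
        3 * weighted f (h ⊕ swap₂₃ h)
          ≡⟨ cong (3 *_) (weighted-⊕ f h (swap₂₃ h)) ⟩
        3 * (weighted f h + weighted f (swap₂₃ h))
          ≡⟨ cong (λ x → 3 * (weighted f h + x)) (weighted-swap₂₃ h) ⟩
        3 * (weighted f h + weighted f h)
          ≡⟨ solve 1 (λ W → con 3 :* (W :+ W) := con 6 :* W) refl (weighted f h) ⟩
        6 * weighted f h ∎

      Σ³-symmetric : (∀ i l → f i i l ≡ 0) → Σ³ f ≡ 6 * weighted f ordered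
      Σ³-symmetric f-diag = trans (Σ³-cong split) (weighted-symmetrize ordered)
        where
        vanishing⇒split : ∀ {i j l} → f i j l ≡ 0 → f i j l ≡ symmetrize ordered i j l * f i j l
        vanishing⇒split {i} {j} {l} f≡0 =
          trans f≡0 (sym (trans (cong (symmetrize ordered i j l *_) f≡0) (*-zeroʳ (symmetrize ordered i j l))))

        split : ∀ i j l → f i j l ≡ symmetrize ordered i j l * f i j l
        split i j l with i Fin.≟ j | j Fin.≟ l | i Fin.≟ l
        ... | yes refl | _        | _        = vanishing⇒split (f-diag i l)
        ... | no _     | yes refl | _        =
          vanishing⇒split (trans (sym (f-swap₁₂ i j j)) (trans (sym (f-swap₂₃ j i j)) (f-diag j i)))
        ... | no _     | no _     | yes refl = vanishing⇒split (trans (f-swap₂₃ i i j) (f-diag i j))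
        ... | no i≢j   | no j≢l   | no i≢l   =
          trans (sym (*-identityˡ _)) (cong (_* f i j l) (sym (symmetrize-ordered≡1 i≢j j≢l i≢l)))

module FirstIndex where
  open import Data.Bool using (Bool; true; false; if_then_else_)
  open import Data.Nat using (zero; suc)
  open import Data.Fin using (Fin) renaming (zero to fzero; suc to fsuc)
  open import Data.Maybe using (Maybe; just; nothing)
  import Data.Maybe as Maybe
  open import Data.Product using (Σ; _,_)
  open import Function using (_∘_)
  open import Relation.Binary.PropositionalEquality

  find : ∀ {n} → (Fin n → Bool) → Maybe (Fin n)
  find {zero}  p = nothing
  find {suc n} p = if p fzero then just fzero else Maybe.map fsuc (find (p ∘ fsuc))

  find-cong : ∀ {n} {p q : Fin n → Bool} → (∀ x → p x ≡ q x) → find p ≡ find q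
  find-cong {zero}  p≗q = refl
  find-cong {suc n} p≗q = cong₂ (λ b m → if b then just fzero else m)
                                (p≗q fzero) (cong (Maybe.map fsuc) (find-cong (p≗q ∘ fsuc)))

  find-complete : ∀ {n} (p : Fin n → Bool) x → p x ≡ true →
                  Σ (Fin n) λ y → find p ≡ just y × p y ≡ true
  find-complete {suc n} p x px with p fzero in p0
  ... | true = fzero , refl , p0
  find-complete {suc n} p fzero    px | false with () ← trans (sym p0) px
  find-complete {suc n} p (fsuc x) px | false with find-complete (p ∘ fsuc) x px
  ... | y , find≡y , py = fsuc y , cong (Maybe.map fsuc) find≡y , py

module Multipartite {v : ℕ} (Γ : Graph v) where
  open Graph Γ renaming (sym to adj-sym)
  open import Data.Bool using (Bool; true; false; not)
  open import Data.Bool.Properties using (not-injective) renaming (_≟_ to _≟ᵇ_)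
  open import Data.Fin using (Fin)
  open import Data.Fin.Properties using (any?)
  open import Data.Maybe using (just)
  open import Data.Maybe.Properties using (just-injective)
  open import Data.Product using (Σ; _,_; proj₁; proj₂)
  open import Data.Empty using (⊥-elim)
  open import Function.Bundles using (mk⇔)
  open import Relation.Nullary using (Dec; yes; no)
  open import Relation.Nullary.Decidable using (_×-dec_)
  open import Relation.Binary.PropositionalEquality
  open FirstIndex

  InducedK₁+K₂ : Set
  InducedK₁+K₂ = Σ (Fin v) λ a → Σ (Fin v) λ b → Σ (Fin v) λ c →
                 adj b c ≡ true × adj a b ≡ false × adj a c ≡ false

  inducedK₁+K₂? : Dec InducedK₁+K₂
  inducedK₁+K₂? = any? λ a → any? λ b → any? λ c →
    (adj b c ≟ᵇ true) ×-dec (adj a b ≟ᵇ false) ×-dec (adj a c ≟ᵇ false)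

  module _ (no-K₁+K₂ : ¬ InducedK₁+K₂) where
    nonadj : Fin v → Fin v → Bool
    nonadj i j = not (adj i j)

    nonadj-refl : ∀ i → nonadj i i ≡ true
    nonadj-refl i = cong not (irrefl i)

    nonadj-sym : ∀ {i j} → nonadj i j ≡ true → nonadj j i ≡ true
    nonadj-sym {i} {j} i≁j = trans (cong not (adj-sym j i)) i≁j

    nonadj-trans : ∀ {i j l} → nonadj i j ≡ true → nonadj j l ≡ true → nonadj i l ≡ true
    nonadj-trans {i} {j} {l} i≁j j≁l with adj i l in i~l
    ... | false = refl
    ... | true  = ⊥-elim (no-K₁+K₂ (j , i , l , i~l , not-injective (nonadj-sym i≁j) , not-injective j≁l))

    nonadj-ext : ∀ {i j} → nonadj i j ≡ true → ∀ l → nonadj i l ≡ nonadj j l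
    nonadj-ext {i} {j} i≁j l with nonadj i l in i≁l | nonadj j l in j≁l
    ... | true  | true  = refl
    ... | false | false = refl
    ... | true  | false = trans (sym (nonadj-trans (nonadj-sym i≁j) i≁l)) j≁l
    ... | false | true  = trans (sym i≁l) (nonadj-trans i≁j j≁l)

    part : Fin v → Fin v
    part i = proj₁ (find-complete (nonadj i) i (nonadj-refl i))

    find≡part : ∀ i → find (nonadj i) ≡ just (part i)
    find≡part i = proj₁ (proj₂ (find-complete (nonadj i) i (nonadj-refl i)))

    nonadj-part : ∀ i → nonadj i (part i) ≡ true
    nonadj-part i = proj₂ (proj₂ (find-complete (nonadj i) i (nonadj-refl i)))

    complete-multipartite : IsCompleteMultipartite Γ
    complete-multipartite = part , λ i j → mk⇔ (adjacent⇒parts≢ i j) (parts≢⇒adjacent i j)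
      where
      adjacent⇒parts≢ : ∀ i j → adj i j ≡ true → part i ≢ part j
      adjacent⇒parts≢ i j i~j part-i≡part-j
        with () ← trans (sym (cong not i~j))
                        (nonadj-trans (nonadj-part i)
                          (nonadj-sym (subst (λ y → nonadj j y ≡ true) (sym part-i≡part-j) (nonadj-part j))))

      parts≢⇒adjacent : ∀ i j → part i ≢ part j → adj i j ≡ true
      parts≢⇒adjacent i j part-i≢part-j with adj i j in i~j
      ... | true  = refl
      ... | false = ⊥-elim (part-i≢part-j (just-injective
        (trans (sym (find≡part i)) (trans (find-cong (nonadj-ext (cong not i~j))) (find≡part j)))))

  ¬complete-multipartite⇒inducedK₁+K₂ : ¬ IsCompleteMultipartite Γ → InducedK₁+K₂
  ¬complete-multipartite⇒inducedK₁+K₂ ¬cm with inducedK₁+K₂?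
  ... | yes K₁+K₂    = K₁+K₂
  ... | no  no-K₁+K₂ = ⊥-elim (¬cm (complete-multipartite no-K₁+K₂))

module Counting {v : ℕ} (Γ : Graph v) where
  open Graph Γ renaming (sym to adj-sym)
  open import Data.Bool using (true; false; _∧_)
  open import Data.Nat using (suc; _+_; _*_; _<_; _<ᵇ_; z≤n; s≤s; NonZero)
  open import Data.Nat.Properties
  open import Data.Nat.Solver using (module +-*-Solver)
  open +-*-Solver using (solve; _:+_; _:*_; _:=_; con)
  open import Algebra.Properties.CommutativeSemigroup *-commutativeSemigroup using (x∙yz≈z∙yx)
  open import Data.Fin using (Fin; toℕ)
  open import Data.Fin.Properties using (nonZeroIndex)
  open import Relation.Binary.PropositionalEquality
  open b2n-Properties
  open Σℕ-Properties
  open SymmetricSums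

  A : Fin v → Fin v → ℕ
  A i j = b2n (adj i j)

  A-sym : ∀ i j → A j i ≡ A i j
  A-sym i j = cong b2n (adj-sym j i)

  A-irrefl : ∀ i → A i i ≡ 0
  A-irrefl i = cong b2n (irrefl i)

  deg : Fin v → ℕ
  deg i = Σℕ (A i)

  common : Fin v → Fin v → ℕ
  common i j = Σℕ λ l → A i l * A j l

  triangle : Fin v → Fin v → Fin v → ℕ
  triangle i j l = A i j * (A j l * A i l)

  Σdeg Σdeg² Σtriangle : ℕ
  Σdeg      = Σℕ deg
  Σdeg²     = Σℕ λ i → deg i * deg i
  Σtriangle = Σ³ triangle

  handshake : Σdeg ≡ 2 * numEdges Γ
  handshake = trans (Σ²-symmetric A A-sym A-irrefl)
                    (cong (2 *_) (Σ²-cong λ i j → sym (b2n-∧ (toℕ i <ᵇ toℕ j) (adj i j))))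

  triangle-swap₁₂ : ∀ i j l → triangle j i l ≡ triangle i j l
  triangle-swap₁₂ i j l = cong₂ _*_ (A-sym i j) (*-comm (A i l) (A j l))

  triangle-swap₂₃ : ∀ i j l → triangle i l j ≡ triangle i j l
  triangle-swap₂₃ i j l =
    trans (cong (λ x → A i l * (x * A i j)) (A-sym j l)) (x∙yz≈z∙yx (A i l) (A j l) (A i j))

  Σtriangle≡6*numTriangles : Σtriangle ≡ 6 * numTriangles Γ
  Σtriangle≡6*numTriangles = trans (Σ³-symmetric triangle-swap₁₂ triangle-swap₂₃ triangle-diag)
                      (cong (6 *_) (Σ³-cong λ i j l → sym (b2n-∧⁵ i j l)))
    where
    triangle-diag : ∀ i l → triangle i i l ≡ 0
    triangle-diag i l = cong (_* (A i l * A i l)) (A-irrefl i)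

    b2n-∧⁵ : ∀ i j l → b2n ((toℕ i <ᵇ toℕ j) ∧ (toℕ j <ᵇ toℕ l) ∧ adj i j ∧ adj j l ∧ adj i l)
                      ≡ ordered i j l * triangle i j l
    b2n-∧⁵ i j l =
      trans (b2n-∧ (toℕ i <ᵇ toℕ j) _) (trans (cong (lt i j *_)
        (trans (b2n-∧ (toℕ j <ᵇ toℕ l) _) (cong (lt j l *_)
          (trans (b2n-∧ (adj i j) _) (cong (A i j *_) (b2n-∧ (adj j l) (adj i l)))))))
        (sym (*-assoc (lt i j) (lt j l) (triangle i j l))))

  Σℕ-1+common : ∀ i j → Σℕ (λ l → 1 + A i l * A j l) ≡ v + common i j
  Σℕ-1+common i j = trans (Σℕ-distrib-+ (λ _ → 1) (λ l → A i l * A j l)) (cong (_+ common i j) (Σℕ-ones v))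

  -- |N(i)| + |N(j)| = |N(i) ∪ N(j)| + |N(i) ∩ N(j)|, and the union misses x.
  deg+deg≤v+common : ∀ i j → deg i + deg j ≤ v + common i j
  deg+deg≤v+common i j = subst₂ _≤_ (Σℕ-distrib-+ (A i) (A j)) (Σℕ-1+common i j)
    (Σℕ-mono-≤ λ l → b2n+b2n≤1+b2n*b2n (adj i l) (adj j l))

  deg+deg<v+common : ∀ i j x → adj i x ≡ false → adj j x ≡ false → deg i + deg j < v + common i j
  deg+deg<v+common i j x i≁x j≁x = subst₂ _<_ (Σℕ-distrib-+ (A i) (A j)) (Σℕ-1+common i j)
    (Σℕ-mono-< (λ l → b2n+b2n≤1+b2n*b2n (adj i l) (adj j l)) x
      (subst₂ (λ p q → b2n p + b2n q < 1 + b2n p * b2n q) (sym i≁x) (sym j≁x) (s≤s z≤n)))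

  Σ²-A*[deg+deg] : Σ² (λ i j → A i j * (deg i + deg j)) ≡ Σdeg² + Σdeg²
  Σ²-A*[deg+deg] = begin
    Σ² (λ i j → A i j * (deg i + deg j))
      ≡⟨ Σ²-cong (λ i j → *-distribˡ-+ (A i j) (deg i) (deg j)) ⟩
    Σ² (λ i j → A i j * deg i + A i j * deg j)
      ≡⟨ Σ²-distrib-+ (λ i j → A i j * deg i) (λ i j → A i j * deg j) ⟩
    Σ² (λ i j → A i j * deg i) + Σ² (λ i j → A i j * deg j)
      ≡⟨ cong (Σ² (λ i j → A i j * deg i) +_) (Σℕ-comm λ i j → A i j * deg j) ⟩
    Σ² (λ i j → A i j * deg i) + Σ² (λ j i → A i j * deg j)
      ≡⟨ cong₂ _+_ (Σℕ-cong λ i → *-distribʳ-Σℕ (deg i) (A i))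
                   (Σℕ-cong λ j → trans (*-distribʳ-Σℕ (deg j) (λ i → A i j))
                                        (cong (_* deg j) (column-sum j))) ⟩
    Σdeg² + Σdeg² ∎
    where
    open ≡-Reasoning
    column-sum : ∀ j → Σℕ (λ i → A i j) ≡ deg j
    column-sum j = Σℕ-cong λ i → A-sym j i

  Σ²-A*[v+common] : Σ² (λ i j → A i j * (v + common i j)) ≡ Σdeg * v + Σtriangle
  Σ²-A*[v+common] = begin
    Σ² (λ i j → A i j * (v + common i j))
      ≡⟨ Σ²-cong (λ i j → *-distribˡ-+ (A i j) v (common i j)) ⟩
    Σ² (λ i j → A i j * v + A i j * common i j)
      ≡⟨ Σ²-distrib-+ (λ i j → A i j * v) (λ i j → A i j * common i j) ⟩
    Σ² (λ i j → A i j * v) + Σ² (λ i j → A i j * common i j)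
      ≡⟨ cong₂ _+_ (trans (Σℕ-cong λ i → *-distribʳ-Σℕ v (A i)) (*-distribʳ-Σℕ v deg))
                   (Σ²-cong λ i j → trans (sym (*-distribˡ-Σℕ (A i j) (λ l → A i l * A j l)))
                                          (Σℕ-cong λ l → cong (A i j *_) (*-comm (A i l) (A j l)))) ⟩
    Σdeg * v + Σtriangle ∎
    where open ≡-Reasoning

  Σdeg²+Σdeg²<Σdeg*v+Σtriangle : ∀ {a b c} → adj b c ≡ true → adj a b ≡ false → adj a c ≡ false →
                                 Σdeg² + Σdeg² < Σdeg * v + Σtriangle
  Σdeg²+Σdeg²<Σdeg*v+Σtriangle {a} {b} {c} b~c a≁b a≁c = subst₂ _<_ Σ²-A*[deg+deg] Σ²-A*[v+common]
    (Σℕ-mono-< (λ i → Σℕ-mono-≤ (bound i)) b (Σℕ-mono-< (bound b) c strict))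
    where
    bound : ∀ i j → A i j * (deg i + deg j) ≤ A i j * (v + common i j)
    bound i j = *-monoʳ-≤ (A i j) (deg+deg≤v+common i j)

    strict : A b c * (deg b + deg c) < A b c * (v + common b c)
    strict = subst (λ k → k * (deg b + deg c) < k * (v + common b c)) (sym (cong b2n b~c))
      (*-monoʳ-< 1 (deg+deg<v+common b c a (trans (adj-sym b a) a≁b) (trans (adj-sym c a) a≁c)))

  A-nonadjacent<1 : ∀ {i j} → adj i j ≡ false → A i j < 1
  A-nonadjacent<1 i≁j = subst (λ p → b2n p < 1) (sym i≁j) (s≤s z≤n)

  deg<v : ∀ i → deg i < v
  deg<v i = subst (deg i <_) (Σℕ-ones v)
    (Σℕ-mono-< (λ j → b2n≤1 (adj i j)) i (A-nonadjacent<1 (irrefl i)))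

  2+deg≤v : ∀ {a b} → a ≢ b → adj a b ≡ false → 2 + deg a ≤ v
  2+deg≤v {a} {b} a≢b a≁b = subst (2 + deg a ≤_) (Σℕ-ones v)
    (Σℕ-mono-<₂ (λ j → b2n≤1 (adj a j)) a b a≢b (A-nonadjacent<1 (irrefl a)) (A-nonadjacent<1 a≁b))

  Σdeg+v<v*v : ∀ {a b} → a ≢ b → adj a b ≡ false → Σdeg + v < v * v
  Σdeg+v<v*v {a} a≢b a≁b =
    subst₂ _<_ (trans (Σℕ-distrib-+ deg (λ _ → 1)) (cong (Σdeg +_) (Σℕ-ones v))) (Σℕ-const v v)
      (Σℕ-mono-< (λ i → subst (_≤ v) (+-comm 1 (deg i)) (deg<v i)) a
                 (subst (_≤ v) (cong suc (+-comm 1 (deg a))) (2+deg≤v a≢b a≁b)))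

  0<Σdeg : ∀ {b c} → adj b c ≡ true → 0 < Σdeg
  0<Σdeg {b} {c} b~c = ≤-trans (subst (λ p → 1 ≤ b2n p) (sym b~c) ≤-refl)
                               (≤-trans (term≤Σℕ (A b) c) (term≤Σℕ deg b))

  2*Σdeg*Σdeg<v*v*Σdeg+Σtriangle*v : ∀ {a b c} → adj b c ≡ true → adj a b ≡ false → adj a c ≡ false →
                                      2 * Σdeg * Σdeg < v * v * Σdeg + Σtriangle * v
  2*Σdeg*Σdeg<v*v*Σdeg+Σtriangle*v {a} b~c a≁b a≁c = begin-strict
    2 * Σdeg * Σdeg
      ≡⟨ *-assoc 2 Σdeg Σdeg ⟩
    2 * (Σdeg * Σdeg)
      ≤⟨ *-monoʳ-≤ 2 (Σℕ-square≤ deg) ⟩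
    2 * (v * Σdeg²)
      ≡⟨ solve 2 (λ v Q → con 2 :* (v :* Q) := v :* (Q :+ Q)) refl v Σdeg² ⟩
    v * (Σdeg² + Σdeg²)
      <⟨ *-monoʳ-< v (Σdeg²+Σdeg²<Σdeg*v+Σtriangle b~c a≁b a≁c) ⟩
    v * (Σdeg * v + Σtriangle)
      ≡⟨ solve 3 (λ v S T → v :* (S :* v :+ T) := v :* v :* S :+ T :* v) refl v Σdeg Σtriangle ⟩
    v * v * Σdeg + Σtriangle * v ∎
    where
    open ≤-Reasoning
    instance
      v-nonZero : NonZero v
      v-nonZero = nonZeroIndex a

module SignsOfParams (F : EuclideanField) {v : ℕ} (Γ : Graph v) where
  open EuclideanField F hiding (_≤_)
  open EuclideanFieldProperties F
  open Solver using (solve; _:+_; _:*_; _:-_; _:=_)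
  open Params F Γ
  open import Algebra.Bundles using (CommutativeRing)
  open CommutativeRing commutativeRing using (*-comm; *-identityˡ)
  import Data.Nat as ℕ
  open import Relation.Binary.PropositionalEquality
  open ≡-Reasoning

  E₂ T₆ : ℕ
  E₂ = 2 ℕ.* numEdges Γ
  T₆ = 6 ℕ.* numTriangles Γ

  e t w : Carrier
  e = fromℕ E₂
  t = fromℕ T₆
  w = V - kbar - 1#

  module _ (0<V : 0# < V) (0<e : 0# < e) (e+V<V*V : e + V < V * V)
           (2ee<VVe+tV : fromℕ 2 * e * e < V * V * e + t * V) where

    0<kbar : 0# < kbar
    0<kbar = /-pos 0<e 0<V

    kbar*V≡e : kbar * V ≡ e
    kbar*V≡e = /-*-cancel e 0<V

    λbar*e≡t : λbar * e ≡ t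
    λbar*e≡t = begin
      t * (V * kbar) ⁻¹ * e   ≡⟨ cong (λ u → t * u ⁻¹ * e) (trans (*-comm V kbar) kbar*V≡e) ⟩
      t / e * e               ≡⟨ /-*-cancel t 0<e ⟩
      t                       ∎

    0<w : 0# < w
    0<w = *-cancelʳ-pos 0<V (subst (0# <_) (sym w*V≡V*V-[e+V]) (x<y⇒0<y-x e+V<V*V))
      where
      w*V≡V*V-[e+V] : w * V ≡ V * V - (e + V)
      w*V≡V*V-[e+V] = begin
        w * V
          ≡⟨ solve 3 (λ V k o → (V :- k :- o) :* V := V :* V :- (k :* V :+ o :* V)) refl V kbar 1# ⟩
        V * V - (kbar * V + 1# * V)
          ≡⟨ cong₂ (λ x y → V * V - (x + y)) kbar*V≡e (*-identityˡ V) ⟩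
        V * V - (e + V) ∎

    0<acoef : 0# < acoef
    0<acoef = *-cancelʳ-pos (*-pos 0<V 0<e) (subst (0# <_) (sym acoef*[V*e]≡) (x<y⇒0<y-x 2ee<VVe+tV))
      where
      acoef*[V*e]≡ : acoef * (V * e) ≡ V * V * e + t * V - fromℕ 2 * e * e
      acoef*[V*e]≡ = begin
        (V + λbar - fromℕ 2 * kbar) * (V * e)
          ≡⟨ solve 5 (λ V l k e d → (V :+ l :- d :* k) :* (V :* e)
                                    := V :* V :* e :+ (l :* e) :* V :- d :* (k :* V) :* e)
                     refl V λbar kbar e (fromℕ 2) ⟩
        V * V * e + (λbar * e) * V - fromℕ 2 * (kbar * V) * e
          ≡⟨ cong₂ (λ x y → V * V * e + x * V - fromℕ 2 * y * e) λbar*e≡t kbar*V≡e ⟩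
        V * V * e + t * V - fromℕ 2 * e * e ∎

    0<sbar : 0# < sbar
    0<sbar = quadratic-root-pos acoef bcoef _ 0<acoef
      (*-pos (*-pos (*-pos (fromℕ-mono-< {0} {4} (ℕ.s≤s ℕ.z≤n)) 0<kbar) 0<w) 0<acoef)

    0<kbar-μbar : 0# < kbar - μbar
    0<kbar-μbar = *-cancelʳ-pos 0<w (subst (0# <_) (sym [kbar-μbar]*w≡kbar*acoef) (*-pos 0<kbar 0<acoef))
      where
      [kbar-μbar]*w≡kbar*acoef : (kbar - μbar) * w ≡ kbar * acoef
      [kbar-μbar]*w≡kbar*acoef = begin
        (kbar - μbar) * w
          ≡⟨ solve 3 (λ k m w → (k :- m) :* w := k :* w :- m :* w) refl kbar μbar w ⟩
        kbar * w - μbar * w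
          ≡⟨ cong (λ u → kbar * w - u) (/-*-cancel _ 0<w) ⟩
        kbar * w - kbar * (kbar - λbar - 1#)
          ≡⟨ solve 4 (λ k l V o → k :* (V :- k :- o) :- k :* (k :- l :- o) := k :* (V :+ l :- (k :+ k)))
                     refl kbar λbar V 1# ⟩
        kbar * (V + λbar - (kbar + kbar))
          ≡⟨ cong (λ u → kbar * (V + λbar - u)) (sym (2*x≡x+x kbar)) ⟩
        kbar * acoef ∎

    θm<0 : θm < 0#
    θm<0 = 0<x⇒-x<0 (/-pos 0<kbar 0<sbar)

    0<θM : 0# < θM
    0<θM = *-pos (/-pos 0<kbar-μbar 0<kbar) 0<sbar

  θm<0<θM : 0 ℕ.< v → 0 ℕ.< E₂ → E₂ ℕ.+ v ℕ.< v ℕ.* v →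
            2 ℕ.* E₂ ℕ.* E₂ ℕ.< v ℕ.* v ℕ.* E₂ ℕ.+ T₆ ℕ.* v → θm < 0# × 0# < θM
  θm<0<θM 0<v 0<E₂ E₂+v<v*v 2EE<vvE+Tv =
    θm<0 0<V 0<e e+V<V*V 2ee<VVe+tV , 0<θM 0<V 0<e e+V<V*V 2ee<VVe+tV
    where
    0<V : 0# < V
    0<V = fromℕ-mono-< 0<v

    0<e : 0# < e
    0<e = fromℕ-mono-< 0<E₂

    e+V<V*V : e + V < V * V
    e+V<V*V = subst₂ _<_ (fromℕ-+ E₂ v) (fromℕ-* v v) (fromℕ-mono-< E₂+v<v*v)

    2ee<VVe+tV : fromℕ 2 * e * e < V * V * e + t * V
    2ee<VVe+tV = subst₂ _<_
      (trans (fromℕ-* (2 ℕ.* E₂) E₂) (cong (_* e) (fromℕ-* 2 E₂)))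
      (trans (fromℕ-+ (v ℕ.* v ℕ.* E₂) (T₆ ℕ.* v))
             (cong₂ _+_ (trans (fromℕ-* (v ℕ.* v) E₂) (cong (_* e) (fromℕ-* v v))) (fromℕ-* T₆ v)))
      (fromℕ-mono-< 2EE<vvE+Tv)

lemma2p22 : (F : EuclideanField) {v : ℕ} → 3 ≤ v → (Γ : Graph v) →
    ¬ IsCompleteMultipartite Γ →
    EuclideanField._<_ F (Params.θm F Γ) (EuclideanField.0# F) ×
    EuclideanField._<_ F (EuclideanField.0# F) (Params.θM F Γ)
lemma2p22 F {v} 3≤v Γ ¬cm with Multipartite.¬complete-multipartite⇒inducedK₁+K₂ Γ ¬cm
... | a , b , c , b~c , a≁b , a≁c =
  SignsOfParams.θm<0<θM F Γ (≤-trans (s≤s z≤n) 3≤v)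
    (subst (0 <_) handshake (0<Σdeg b~c))
    (subst (λ E₂ → E₂ + v < v * v) handshake (Σdeg+v<v*v a≢b a≁b))
    (subst₂ (λ E₂ T₆ → 2 * E₂ * E₂ < v * v * E₂ + T₆ * v) handshake Σtriangle≡6*numTriangles
            (2*Σdeg*Σdeg<v*v*Σdeg+Σtriangle*v b~c a≁b a≁c))
  where
  open import Data.Nat using (_+_; _*_; _<_; s≤s; z≤n)
  open import Data.Nat.Properties using (≤-trans)
  open import Relation.Binary.PropositionalEquality using (_≢_; refl; sym; trans; subst; subst₂)
  open Counting Γ

  a≢b : a ≢ b
  a≢b refl with () ← trans (sym b~c) a≁c
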